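{- For all integers $m,q\ge0$, \[ \mathbf 1_{((q+1)\,\&\,m=0)}\oplus\mathbf 1_{((q+1)\,\&\,(m+1)=0)}=\mathbf 1_{(q\,\&\,(m+1)=0)}. \]
   Context: $\&$ is bitwise AND of binary expansions, $\oplus$ is addition modulo $2$, and $\mathbf 1_{(\cdot)}$ is $1$ if the condition holds and $0$ otherwise. -}

module Defs where

open import Data.Nat using (ℕ; zero; suc; _+_; _*_; _%_; _/_; _≡ᵇ_)
open import Data.Bool using (Bool; true; false; _xor_)

-- Bitwise AND of binary expansions, by recursion on the lowest bit:
--   a & b = 2 * ((a / 2) & (b / 2)) + (a % 2) * (b % 2)
-- A fuel argument makes the recursion structural; fuel = a (with a = 0 ⇒ result 0)
-- always suffices, since a / 2 < a for a > 0.
andFuel : ℕ → ℕ → ℕ → ℕ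
andFuel zero    _ _ = zero
andFuel (suc f) a b = 2 * andFuel f (a / 2) (b / 2) + (a % 2) * (b % 2)

infixl 7 _&_
_&_ : ℕ → ℕ → ℕ
a & b = andFuel a a b

-- indicator 1_{(x = 0)} as a Boolean (𝟙 ∈ {0,1} ≅ Bool, ⊕ ≅ xor)
isZero : ℕ → Bool
isZero n = n ≡ᵇ 0

-- Write m = r + 2j and q = s + 2k with binary digits r, s. Since (r + 2a) & (s + 2b) = r s + 2 (a & b),
-- each of the three ANDs vanishes iff its two lowest digits are not both 1 and the ANDs of the
-- halves vanish. In three of the four digit cases this turns the identity into a Boolean tautology;
-- when m and q are both odd it becomes the same identity for (j, k).
module Submission where

open import Defs
open import Data.Nat using (ℕ; zero; suc; _+_; _*_; _/_; _%_; _≤_; _<_; NonZero; z≤n; s≤s; z<s; s<s)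
open import Data.Nat.Properties
open import Data.Nat.DivMod
open import Data.Nat.Divisibility using (divides-refl)
open import Data.Nat.Induction using (<-rec)
open import Data.Bool using (false; _∧_; _xor_)
open import Data.Bool.Properties using (xor-identityʳ; xor-same)
open import Relation.Binary.PropositionalEquality
open ≡-Reasoning

andFuel-zeroˡ : ∀ f b → andFuel f 0 b ≡ 0
andFuel-zeroˡ zero    b = refl
andFuel-zeroˡ (suc f) b = cong (_+ 0) (cong (2 *_) (andFuel-zeroˡ f (b / 2)))

[1+n]/2≤n : ∀ n → suc n / 2 ≤ n
[1+n]/2≤n n = ≤-pred (m/n<m (suc n) 2 (s≤s (s≤s z≤n)))

andFuel-stable : ∀ f g a b → a ≤ f → a ≤ g → andFuel f a b ≡ andFuel g a b
andFuel-stable f g zero b _ _ = trans (andFuel-zeroˡ f b) (sym (andFuel-zeroˡ g b))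
andFuel-stable (suc f) (suc g) a@(suc a-1) b (s≤s a-1≤f) (s≤s a-1≤g) =
  cong (λ h → 2 * h + a % 2 * (b % 2))
    (andFuel-stable f g (a / 2) (b / 2) (≤-trans ([1+n]/2≤n a-1) a-1≤f) (≤-trans ([1+n]/2≤n a-1) a-1≤g))

&-unfold : ∀ a b → a & b ≡ 2 * ((a / 2) & (b / 2)) + a % 2 * (b % 2)
&-unfold zero        b = refl
&-unfold a@(suc a-1) b =
  cong (λ h → 2 * h + a % 2 * (b % 2))
    (andFuel-stable a-1 (a / 2) (a / 2) (b / 2) ([1+n]/2≤n a-1) ≤-refl)

[m+kn]/n≡k : ∀ {m n} k .{{_ : NonZero n}} → m < n → (m + k * n) / n ≡ k
[m+kn]/n≡k {m} {n} k m<n = begin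
  (m + k * n) / n    ≡⟨ +-distrib-/-∣ʳ m (divides-refl k) ⟩
  m / n + k * n / n  ≡⟨ cong₂ _+_ (m<n⇒m/n≡0 m<n) (m*n/n≡m k n) ⟩
  k                  ∎

[m+kn]%n≡m : ∀ {m n} k .{{_ : NonZero n}} → m < n → (m + k * n) % n ≡ m
[m+kn]%n≡m {m} {n} k m<n = trans ([m+kn]%n≡m%n m k n) (m<n⇒m%n≡m m<n)

&-digits : ∀ {r s} a b → r < 2 → s < 2 → (r + a * 2) & (s + b * 2) ≡ r * s + (a & b) * 2
&-digits {r} {s} a b r<2 s<2 = begin
  (r + a * 2) & (s + b * 2)
    ≡⟨ &-unfold (r + a * 2) (s + b * 2) ⟩
  2 * (((r + a * 2) / 2) & ((s + b * 2) / 2)) + (r + a * 2) % 2 * ((s + b * 2) % 2)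
    ≡⟨ cong₂ (λ h d → 2 * h + d)
         (cong₂ _&_ ([m+kn]/n≡k a r<2) ([m+kn]/n≡k b s<2))
         (cong₂ _*_ ([m+kn]%n≡m a r<2) ([m+kn]%n≡m b s<2)) ⟩
  2 * (a & b) + r * s
    ≡⟨ +-comm (2 * (a & b)) (r * s) ⟩
  r * s + 2 * (a & b)
    ≡⟨ cong (r * s +_) (*-comm 2 (a & b)) ⟩
  r * s + (a & b) * 2
    ∎

isZero-+ : ∀ m n → isZero (m + n) ≡ isZero m ∧ isZero n
isZero-+ zero    n = refl
isZero-+ (suc m) n = refl

isZero-*2 : ∀ n → isZero (n * 2) ≡ isZero n
isZero-*2 zero    = refl
isZero-*2 (suc n) = refl

isZero-&-digits : ∀ {r s} a b → r < 2 → s < 2 →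
  isZero ((r + a * 2) & (s + b * 2)) ≡ isZero (r * s) ∧ isZero (a & b)
isZero-&-digits {r} {s} a b r<2 s<2 = begin
  isZero ((r + a * 2) & (s + b * 2))    ≡⟨ cong isZero (&-digits a b r<2 s<2) ⟩
  isZero (r * s + (a & b) * 2)          ≡⟨ isZero-+ (r * s) ((a & b) * 2) ⟩
  isZero (r * s) ∧ isZero ((a & b) * 2) ≡⟨ cong (isZero (r * s) ∧_) (isZero-*2 (a & b)) ⟩
  isZero (r * s) ∧ isZero (a & b)       ∎

isZero-&-even-even : ∀ a b → isZero ((a * 2) & (b * 2)) ≡ isZero (a & b)
isZero-&-even-even a b = isZero-&-digits a b z<s z<s

isZero-&-even-odd : ∀ a b → isZero ((a * 2) & (1 + b * 2)) ≡ isZero (a & b)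
isZero-&-even-odd a b = isZero-&-digits a b z<s (s<s z<s)

isZero-&-odd-even : ∀ a b → isZero ((1 + a * 2) & (b * 2)) ≡ isZero (a & b)
isZero-&-odd-even a b = isZero-&-digits a b (s<s z<s) z<s

isZero-&-odd-odd : ∀ a b → isZero ((1 + a * 2) & (1 + b * 2)) ≡ false
isZero-&-odd-odd a b = isZero-&-digits a b (s<s z<s) (s<s z<s)

data ParityView : ℕ → Set where
  even : ∀ k → ParityView (k * 2)
  odd  : ∀ k → ParityView (1 + k * 2)

parityView : ∀ n → ParityView n
parityView zero          = even 0
parityView (suc zero)    = odd 0
parityView (suc (suc n)) with parityView n
... | even k = even (suc k)
... | odd  k = odd (suc k)

AndIdentity : ℕ → Set
AndIdentity m = ∀ q → (isZero (suc q & m) xor isZero (suc q & suc m)) ≡ isZero (q & suc m)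

-- Adding 1 to an odd number 1 + k * 2 gives suc k * 2 definitionally, so q + 1 and m + 1 need no re-splitting.
and-identity-step : ∀ m → (∀ {j} → j < m → AndIdentity j) → AndIdentity m
and-identity-step m ih q with parityView m | parityView q
... | even j | even k = begin
  isZero (suc q & m) xor isZero (suc q & suc m) ≡⟨ cong₂ _xor_ (isZero-&-odd-even k j) (isZero-&-odd-odd k j) ⟩
  isZero (k & j) xor false                      ≡⟨ xor-identityʳ (isZero (k & j)) ⟩
  isZero (k & j)                                ≡⟨ isZero-&-even-odd k j ⟨
  isZero (q & suc m)                            ∎
... | even j | odd k = begin
  isZero (suc q & m) xor isZero (suc q & suc m) ≡⟨ cong₂ _xor_ (isZero-&-even-even (suc k) j) (isZero-&-even-odd (suc k) j) ⟩
  isZero (suc k & j) xor isZero (suc k & j)     ≡⟨ xor-same (isZero (suc k & j)) ⟩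
  false                                         ≡⟨ isZero-&-odd-odd k j ⟨
  isZero (q & suc m)                            ∎
... | odd j | even k = begin
  isZero (suc q & m) xor isZero (suc q & suc m) ≡⟨ cong₂ _xor_ (isZero-&-odd-odd k j) (isZero-&-odd-even k (suc j)) ⟩
  isZero (k & suc j)                            ≡⟨ isZero-&-even-even k (suc j) ⟨
  isZero (q & suc m)                            ∎
... | odd j | odd k = begin
  isZero (suc q & m) xor isZero (suc q & suc m) ≡⟨ cong₂ _xor_ (isZero-&-even-odd (suc k) j) (isZero-&-even-even (suc k) (suc j)) ⟩
  isZero (suc k & j) xor isZero (suc k & suc j) ≡⟨ ih (s≤s (m≤m*n j 2)) k ⟩
  isZero (k & suc j)                            ≡⟨ isZero-&-odd-even k (suc j) ⟨
  isZero (q & suc m)                            ∎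

lemma4 : ∀ (m q : ℕ) →
    (isZero (suc q & m) xor isZero (suc q & suc m)) ≡ isZero (q & suc m)
lemma4 = <-rec AndIdentity and-identity-step
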